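{- Let $G$ be a graph with $n$ vertices and $m$ edges in which every vertex has even degree, and let $k$ be a positive integer. Then there is a sequence of at most $k$ exclusive vertex splits transforming $G$ into a cycle graph if and only if $k\ge m-n$.
   Context: All graphs are finite, simple and undirected. An exclusive vertex split of a vertex $v$ removes $v$ and adds two new vertices $v_1,v_2$ with $N(v_1)\cup N(v_2)=N(v)$ and $N(v_1)\cap N(v_2)=\emptyset$; no other adjacencies change. A cycle graph is a disjoint union of cycles. -}

module Defs where

open import Data.Nat using (ℕ; zero; suc; _+_)
open import Data.Bool using (Bool; true; false; if_then_else_; _∧_; not)
open import Data.Fin using (Fin; zero; suc; _≟_; _<_)
open import Data.Fin.Permutation using (Permutation′; _⟨$⟩ʳ_)
open import Data.List using (List; allFin; filter; length; concatMap; map)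
open import Data.Product using (Σ; _×_; _,_)
open import Data.Sum using (_⊎_)
open import Relation.Nullary using (¬_; does)
open import Relation.Binary.PropositionalEquality using (_≡_; _≢_)
import Data.Fin.Properties as FinP

record Graph (n : ℕ) : Set where
  field
    adj    : Fin n → Fin n → Bool
    sym    : ∀ u w → adj u w ≡ adj w u
    irrefl : ∀ u → adj u u ≡ false
open Graph public

neighbours : ∀ {n} → Graph n → Fin n → List (Fin n)
neighbours G v = filter (λ w → adj G v w ≡? true) (allFin _)
  where
    _≡?_ : (b c : Bool) → _
    _≡?_ = Data.Bool._≟_
      where import Data.Bool

degree : ∀ {n} → Graph n → Fin n → ℕ
degree G v = length (neighbours G v)

edgeList : ∀ {n} → Graph n → List (Σ (Fin n) λ _ → Fin n)
edgeList {n} G =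
  filter (λ { (u , w) → does (u FinP.<? w) Data.Bool.≟ true ×-dec (adj G u w Data.Bool.≟ true) })
         (concatMap (λ u → map (λ w → (u , w)) (allFin n)) (allFin n))
  where
    import Data.Bool
    open import Relation.Nullary.Decidable using (_×-dec_)

numEdges : ∀ {n} → Graph n → ℕ
numEdges G = length (edgeList G)

data Even : ℕ → Set where
  even-zero : Even zero
  even-ss   : ∀ {k} → Even k → Even (suc (suc k))

-- In the new graph (on Fin (suc n)),
-- vertex  suc u  is the old vertex u (with  suc v  playing the role of v₁) and
-- vertex  zero  is the new vertex v₂.  S selects which neighbours of v go to v₁;
-- the remaining neighbours go to v₂; v₁ and v₂ are not adjacent.
splitAdj : ∀ {n} → Graph n → Fin n → (Fin n → Bool) → Fin (suc n) → Fin (suc n) → Bool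
splitAdj G v S zero    zero    = false
splitAdj G v S zero    (suc w) = adj G v w ∧ not (S w)
splitAdj G v S (suc u) zero    = adj G v u ∧ not (S u)
splitAdj G v S (suc u) (suc w) =
  if does (u ≟ v) then adj G v w ∧ S w
  else if does (w ≟ v) then adj G u v ∧ S u
  else adj G u w

ExclusiveSplit : ∀ {n} → Graph n → Graph (suc n) → Set
ExclusiveSplit {n} G H =
  Σ (Fin n) λ v → Σ (Fin n → Bool) λ S →
    ∀ a b → adj H a b ≡ splitAdj G v S a b

data SplitSeq : ∀ {n n′} → Graph n → Graph n′ → ℕ → Set where
  done : ∀ {n} {G : Graph n} → SplitSeq G G 0
  step : ∀ {n n′ j} {G : Graph n} {G′ : Graph (suc n)} {H : Graph n′} →
         ExclusiveSplit G G′ → SplitSeq G′ H j → SplitSeq G H (suc j)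

-- A cycle graph (disjoint union of cycles): there is a permutation π of the
-- vertices, each of whose orbits has length ≥ 3, such that u ~ w exactly when
-- one of them is the π-successor of the other (each orbit is one cycle).
IsCycleGraph : ∀ {n} → Graph n → Set
IsCycleGraph {n} G =
  Σ (Permutation′ n) λ π →
    (∀ v → π ⟨$⟩ʳ v ≢ v) ×
    (∀ v → π ⟨$⟩ʳ (π ⟨$⟩ʳ v) ≢ v) ×
    (∀ u w → adj G u w ≡ true → (π ⟨$⟩ʳ u ≡ w) ⊎ (π ⟨$⟩ʳ w ≡ u)) ×
    (∀ u w → (π ⟨$⟩ʳ u ≡ w) ⊎ (π ⟨$⟩ʳ w ≡ u) → adj G u w ≡ true)

-- Exclusive splits keep the degree sum 2m and add one vertex each, while every vertex of a
-- cycle graph has degree 2; so j splits ending in a cycle graph force 2m = 2(n + j), that is,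
-- j = m − n. Conversely, as long as some vertex has degree at least 4, moving two of its
-- neighbours to a new vertex keeps all degrees even and positive, so splitting ends in a
-- 2-regular graph. A 2-regular graph is a cycle graph, by induction: a vertex u either lies on a
-- triangle, which is then a whole component, or has non-adjacent neighbours a and b, in which
-- case u is suppressed into an edge ab; an orientation of the smaller graph extends back.

{-# OPTIONS --safe #-}
module Submission where

open import Defs renaming (sym to adj-sym; irrefl to adj-irrefl)

open import Data.Bool using (Bool; true; false; _∧_; _∨_; not; if_then_else_)
import Data.Bool as Bool
open import Data.Bool.Properties using (∧-zeroʳ; ∧-identityʳ; ∨-zeroʳ; not-¬)
open import Data.Empty using (⊥-elim)
open import Data.Fin using (Fin; zero; suc; _≟_; punchIn)
open import Data.Fin.Permutation
  using (Permutation′; _⟨$⟩ʳ_; _⟨$⟩ˡ_; inverseˡ; inverseʳ; transpose; _∘ₚ_)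
import Data.Fin.Permutation as Perm
import Data.Fin.Permutation.Components as PC
open import Data.Fin.Properties using (punchInᵢ≢i; _<?_; <-cmp; any?)
open import Data.Fin.Subset using (Subset; _∈_; _∉_; ⁅_⁆; ∣_∣; ⊤; Empty)
  renaming (_-_ to infixl 5 _∖_)
open import Data.Fin.Subset.Properties
  using (_∈?_; nonempty?; ∈⊤; x∈p∧x≢y⇒x∈p-y; p─q⊆p; x∈p⇒∣p-x∣<∣p∣; ∣p─q∣≤∣p∣)
open import Data.Integer using (+_; _-_; _⊖_)
import Data.Integer as ℤ
open import Data.Integer.Properties using ([+m]-[+n]≡m⊖n; ≤-⊖; drop‿+≤+)
open import Data.List using (List; _++_; filter; length; concat; map; tabulate; allFin)
open import Data.List.Properties using (filter-++; length-++; map-tabulate)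
open import Data.Nat using (ℕ; zero; suc; _+_; _*_; _∸_; _≤_; _<_; z≤n; s≤s; s≤s⁻¹)
open import Data.Nat.Induction using (<-wellFounded)
open import Data.Nat.Properties
  using ( +-0-commutativeMonoid; +-assoc; +-comm; +-identityʳ; +-suc; +-mono-≤; +-cancelˡ-≤
        ; +-cancelˡ-≡; *-comm; *-cancelˡ-≡; ≤-refl; ≤-reflexive; ≤-trans; ≤-<-trans; ≤-pred; _≤?_
        ; m≤m+n; m≤n+m; m+n∸m≡n; m≤n⇒∃[o]m+o≡n; module ≤-Reasoning )
open import Algebra.Properties.CommutativeMonoid.Sum +-0-commutativeMonoid
  using (sum; sum-cong-≗; ∑-distrib-+; ∑-comm; sum-remove)
open import Data.Product using (Σ; ∃; ∃₂; _×_; _,_; proj₁; proj₂)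
open import Data.Sum using (_⊎_; inj₁; inj₂; [_,_]′)
import Data.Sum as Sum
open import Data.Vec using (_∷_; there)
open import Data.Vec.Functional using (removeAt)
open import Function using (_∘_; id)
open import Function.Bundles using (_⇔_; mk⇔)
open import Induction.WellFounded using (Acc; acc)
open import Level using (0ℓ)
open import Relation.Binary.Core using (Rel)
open import Relation.Binary.Definitions using (Symmetric; tri<; tri≈; tri>)
open import Relation.Binary.PropositionalEquality
open import Relation.Nullary using (¬_; Dec; does; yes; no; contradiction)
open import Relation.Nullary.Decidable using (dec-true; dec-false; _×-dec_)
open import Relation.Unary using (Pred; Decidable)

private variable
  n : ℕ

-- Sums and counts over Fin n

sum-const : ∀ n c → sum {n} (λ _ → c) ≡ n * c
sum-const zero    c = refl
sum-const (suc n) c = cong (_+_ c) (sum-const n c)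

sum-mono-≤ : {f g : Fin n → ℕ} → (∀ i → f i ≤ g i) → sum f ≤ sum g
sum-mono-≤ {zero}  f≤g = z≤n
sum-mono-≤ {suc n} f≤g = +-mono-≤ (f≤g zero) (sum-mono-≤ (f≤g ∘ suc))

sum-agree-off : ∀ {f g : Fin n → ℕ} v c → (∀ i → i ≢ v → f i ≡ g i) → c + f v ≡ g v → c + sum f ≡ sum g
sum-agree-off {suc n} {f} {g} v c f≡g c+fv≡gv = begin
  c + sum f                        ≡⟨ cong (_+_ c) (sum-remove {i = v} f) ⟩
  c + (f v + sum (removeAt f v))   ≡⟨ +-assoc c (f v) _ ⟨
  c + f v + sum (removeAt f v)     ≡⟨ cong₂ _+_ c+fv≡gv (sum-cong-≗ λ i → f≡g _ (punchInᵢ≢i v i)) ⟩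
  g v + sum (removeAt g v)         ≡⟨ sum-remove {i = v} g ⟨
  sum g                            ∎
  where open ≡-Reasoning

sum-≥-peak : ∀ {f : Fin n → ℕ} {c e} v → (∀ u → c ≤ f u) → c + e ≤ f v → e + n * c ≤ sum f
sum-≥-peak {suc m} {f} {c} {e} v c≤f c+e≤fv = begin
  e + (c + m * c)                 ≡⟨ +-assoc e c (m * c) ⟨
  e + c + m * c                   ≡⟨ cong (_+ m * c) (+-comm e c) ⟩
  c + e + m * c                   ≤⟨ +-mono-≤ c+e≤fv m*c≤rest ⟩
  f v + sum (removeAt f v)        ≡⟨ sum-remove {i = v} f ⟨
  sum f                           ∎
  where
  open ≤-Reasoning
  m*c≤rest : m * c ≤ sum (removeAt f v)
  m*c≤rest = subst (_≤ sum (removeAt f v)) (sum-const m c) (sum-mono-≤ (λ i → c≤f (punchIn v i)))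

bit : Bool → ℕ
bit true  = 1
bit false = 0

count : (Fin n → Bool) → ℕ
count p = sum (bit ∘ p)

count-cong : {p q : Fin n → Bool} → p ≗ q → count p ≡ count q
count-cong p≗q = sum-cong-≗ (cong bit ∘ p≗q)

count-none : {p : Fin n → Bool} → (∀ i → p i ≡ false) → count p ≡ 0
count-none {zero}  none = refl
count-none {suc n} none = cong₂ (λ b c → bit b + c) (none zero) (count-none (none ∘ suc))

bit-∧-partition : ∀ b s → bit (b ∧ not s) + bit (b ∧ s) ≡ bit b
bit-∧-partition true  true  = refl
bit-∧-partition true  false = refl
bit-∧-partition false s     = refl

count-partition : ∀ (p s : Fin n → Bool) →
  count (λ i → p i ∧ not (s i)) + count (λ i → p i ∧ s i) ≡ count p
count-partition p s =
  trans (sym (∑-distrib-+ (bit ∘ λ i → p i ∧ not (s i)) (bit ∘ λ i → p i ∧ s i)))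
        (sum-cong-≗ λ i → bit-∧-partition (p i) (s i))

without : (Fin n → Bool) → Fin n → Fin n → Bool
without p a i = p i ∧ not (does (i ≟ a))

without-self : ∀ (p : Fin n → Bool) a → without p a a ≡ false
without-self p a rewrite dec-true (a ≟ a) refl = ∧-zeroʳ (p a)

without-other : ∀ (p : Fin n → Bool) {a i} → i ≢ a → without p a i ≡ p i
without-other p {a} {i} i≢a rewrite dec-false (i ≟ a) i≢a = ∧-identityʳ (p i)

without-true : ∀ (p : Fin n → Bool) {a i} → without p a i ≡ true → p i ≡ true × i ≢ a
without-true p {a} {i} eq with p i | i ≟ a
... | true | no i≢a = refl , i≢a

count-remove : ∀ (p : Fin n → Bool) {a} → p a ≡ true → count p ≡ suc (count (without p a))
count-remove {suc n} p {a} pa = begin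
  count p                                     ≡⟨ sum-remove {i = a} (bit ∘ p) ⟩
  bit (p a) + count (removeAt p a)            ≡⟨ cong₂ (λ b c → bit b + c) pa (count-cong λ i →
                                                   sym (without-other p (punchInᵢ≢i a i))) ⟩
  suc (bit false + count (removeAt p′ a))     ≡⟨ cong (λ b → suc (bit b + count (removeAt p′ a)))
                                                   (sym (without-self p a)) ⟩
  suc (bit (p′ a) + count (removeAt p′ a))    ≡⟨ cong suc (sum-remove {i = a} (bit ∘ p′)) ⟨
  suc (count p′)                              ∎
  where
  open ≡-Reasoning
  p′ : Fin (suc n) → Bool
  p′ = without p a

count-witness : ∀ (p : Fin n → Bool) → 1 ≤ count p → ∃ λ a → p a ≡ true
count-witness {suc n} p 1≤count with p zero in eq
... | true  = zero , eq
... | false with count-witness (p ∘ suc) 1≤count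
...   | a , pa = suc a , pa

count-witnesses₂ : ∀ (p : Fin n → Bool) → 2 ≤ count p →
  ∃₂ λ a b → a ≢ b × p a ≡ true × p b ≡ true
count-witnesses₂ p 2≤count with count-witness p (≤-trans (s≤s z≤n) 2≤count)
... | a , pa with count-witness (without p a) (≤-pred (subst (2 ≤_) (count-remove p pa) 2≤count))
...   | b , p′b with without-true p p′b
...     | pb , b≢a = a , b , b≢a ∘ sym , pa , pb

record ExactlyAt (P : Pred (Fin n) 0ℓ) (a b : Fin n) : Set where
  field
    distinct : a ≢ b
    holds₁   : P a
    holds₂   : P b
    only     : ∀ {w} → P w → w ≡ a ⊎ w ≡ b

module _ {P : Pred (Fin n) 0ℓ} {a b : Fin n} (exactly : ExactlyAt P a b) where
  open ExactlyAt exactly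

  exactlyAt-reselect : ∀ {c d} → P c → P d → c ≢ d → ExactlyAt P c d
  exactlyAt-reselect {c} {d} Pc Pd c≢d =
    record { distinct = c≢d ; holds₁ = Pc ; holds₂ = Pd ; only = only′ }
    where
    only′ : ∀ {w} → P w → w ≡ c ⊎ w ≡ d
    only′ Pw with only Pc | only Pd | only Pw
    ... | inj₁ refl | inj₁ refl | _         = contradiction refl c≢d
    ... | inj₂ refl | inj₂ refl | _         = contradiction refl c≢d
    ... | inj₁ refl | inj₂ refl | w≡c⊎w≡d   = w≡c⊎w≡d
    ... | inj₂ refl | inj₁ refl | w≡d⊎w≡c   = Sum.swap w≡d⊎w≡c

  exactlyAt-other : ∀ {c} → P c → ∃ (ExactlyAt P c)
  exactlyAt-other Pc with only Pc
  ... | inj₁ refl = b , exactly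
  ... | inj₂ refl = a , exactlyAt-reselect Pc holds₁ (distinct ∘ sym)

  exactlyAt-dec : ∀ w → Dec (P w)
  exactlyAt-dec w with w ≟ a | w ≟ b
  ... | yes refl | _        = yes holds₁
  ... | no _     | yes refl = yes holds₂
  ... | no w≢a   | no w≢b   = no λ Pw → [ w≢a , w≢b ]′ (only Pw)

count-remove₂ : ∀ (p : Fin n → Bool) {a b} → a ≢ b → p a ≡ true → p b ≡ true →
                count p ≡ 2 + count (without (without p a) b)
count-remove₂ p a≢b pa pb =
  trans (count-remove p pa) (cong suc (count-remove (without p _) (trans (without-other p (a≢b ∘ sym)) pb)))

count-exactly-two : ∀ (p : Fin n → Bool) {a b} → ExactlyAt (λ i → p i ≡ true) a b → count p ≡ 2
count-exactly-two p {a} {b} exactly =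
  trans (count-remove₂ p distinct holds₁ holds₂) (cong (λ k → 2 + k) (count-none none))
  where
  open ExactlyAt exactly
  none : ∀ i → without (without p a) b i ≡ false
  none i with without (without p a) b i in eq
  ... | false = refl
  ... | true with without-true (without p a) eq
  ...   | p′i , i≢b with without-true p p′i
  ...     | pi , i≢a = ⊥-elim ([ i≢a , i≢b ]′ (only pi))

count≡2⇒exactly-two : ∀ (p : Fin n → Bool) → count p ≡ 2 → ∃₂ (ExactlyAt (λ i → p i ≡ true))
count≡2⇒exactly-two p count≡2 with count-witnesses₂ p (≤-reflexive (sym count≡2))
... | a , b , a≢b , pa , pb = a , b , record
  { distinct = a≢b ; holds₁ = pa ; holds₂ = pb ; only = only }
  where
  rest≡0 : count (without (without p a) b) ≡ 0
  rest≡0 = +-cancelˡ-≡ 2 _ _ (trans (sym (count-remove₂ p a≢b pa pb)) count≡2)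
  only : ∀ {w} → p w ≡ true → w ≡ a ⊎ w ≡ b
  only {w} pw with w ≟ a | w ≟ b
  ... | yes w≡a | _       = inj₁ w≡a
  ... | no _    | yes w≡b = inj₂ w≡b
  ... | no w≢a  | no w≢b  =
    contradiction (trans (sym rest≡0) (count-remove (without (without p a) b) p″w)) λ ()
    where
    p″w : without (without p a) b w ≡ true
    p″w = trans (without-other (without p a) w≢b) (trans (without-other p w≢a) pw)

-- Degrees and the handshake lemma

deg : Graph n → Fin n → ℕ
deg G v = count (adj G v)

length-filter-tabulate : ∀ {a} {A : Set a} {P : Pred A 0ℓ} (P? : Decidable P) (g : Fin n → A) →
  length (filter P? (tabulate g)) ≡ count (λ i → does (P? (g i)))
length-filter-tabulate {zero}  P? g = refl
length-filter-tabulate {suc n} P? g with does (P? (g zero))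
... | true  = cong suc (length-filter-tabulate P? (g ∘ suc))
... | false = length-filter-tabulate P? (g ∘ suc)

length-filter-concat-tabulate : ∀ {a} {A : Set a} {P : Pred A 0ℓ} (P? : Decidable P) (g : Fin n → List A) →
  length (filter P? (concat (tabulate g))) ≡ sum (λ i → length (filter P? (g i)))
length-filter-concat-tabulate {zero}  P? g = refl
length-filter-concat-tabulate {suc n} P? g = begin
  length (filter P? (g zero ++ concat (tabulate (g ∘ suc))))
    ≡⟨ cong length (filter-++ P? (g zero) _) ⟩
  length (filter P? (g zero) ++ filter P? (concat (tabulate (g ∘ suc))))
    ≡⟨ length-++ (filter P? (g zero)) ⟩
  length (filter P? (g zero)) + length (filter P? (concat (tabulate (g ∘ suc))))
    ≡⟨ cong (_+_ (length (filter P? (g zero)))) (length-filter-concat-tabulate P? (g ∘ suc)) ⟩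
  sum (λ i → length (filter P? (g i)))
    ∎
  where open ≡-Reasoning

does-≟-true : ∀ b → does (b Bool.≟ true) ≡ b
does-≟-true true  = refl
does-≟-true false = refl

degree≡deg : ∀ (G : Graph n) v → degree G v ≡ deg G v
degree≡deg G v = trans (length-filter-tabulate (λ w → adj G v w Bool.≟ true) id)
                       (count-cong λ w → does-≟-true (adj G v w))

numEdges≡ : ∀ (G : Graph n) → numEdges G ≡ sum (λ u → count (λ w → does (u <? w) ∧ adj G u w))
numEdges≡ {n} G = begin
  length (filter P? (concat (map pairs (tabulate id))))
    ≡⟨ cong (λ ps → length (filter P? (concat ps))) (map-tabulate id pairs) ⟩
  length (filter P? (concat (tabulate pairs)))
    ≡⟨ length-filter-concat-tabulate P? pairs ⟩
  sum (λ u → length (filter P? (map (u ,_) (tabulate id))))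
    ≡⟨ sum-cong-≗ (λ u → cong (length ∘ filter P?) (map-tabulate id (u ,_))) ⟩
  sum (λ u → length (filter P? (tabulate (u ,_))))
    ≡⟨ sum-cong-≗ (λ u → length-filter-tabulate P? (u ,_)) ⟩
  sum (λ u → count (λ w → does (P? (u , w))))
    ≡⟨ sum-cong-≗ (λ u → count-cong λ w →
         cong₂ _∧_ (does-≟-true (does (u <? w))) (does-≟-true (adj G u w))) ⟩
  sum (λ u → count (λ w → does (u <? w) ∧ adj G u w))
    ∎
  where
  open ≡-Reasoning
  P? : Decidable {A = Fin n × Fin n} λ (u , w) → does (u <? w) ≡ true × adj G u w ≡ true
  P? (u , w) = (does (u <? w) Bool.≟ true) ×-dec (adj G u w Bool.≟ true)
  pairs : Fin n → List (Fin n × Fin n)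
  pairs u = map (u ,_) (allFin n)

adj-split : ∀ (G : Graph n) u w →
  bit (adj G u w) ≡ bit (does (u <? w) ∧ adj G u w) + bit (does (w <? u) ∧ adj G w u)
adj-split G u w with <-cmp u w
... | tri< u<w _ w≮u rewrite dec-true (u <? w) u<w | dec-false (w <? u) w≮u = sym (+-identityʳ _)
... | tri≈ u≮u refl _ rewrite dec-false (u <? u) u≮u | adj-irrefl G u = refl
... | tri> u≮w _ w<u rewrite dec-false (u <? w) u≮w | dec-true (w <? u) w<u = cong bit (adj-sym G u w)

handshake : ∀ (G : Graph n) → sum (deg G) ≡ 2 * numEdges G
handshake {n} G = begin
  sum (λ u → sum (λ w → bit (adj G u w)))
    ≡⟨ sum-cong-≗ (λ u → sum-cong-≗ (adj-split G u)) ⟩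
  sum (λ u → sum (λ w → E u w + E w u))
    ≡⟨ sum-cong-≗ (λ u → ∑-distrib-+ (E u) (λ w → E w u)) ⟩
  sum (λ u → sum (E u) + sum (λ w → E w u))
    ≡⟨ ∑-distrib-+ (λ u → sum (E u)) (λ u → sum (λ w → E w u)) ⟩
  sum (λ u → sum (E u)) + sum (λ u → sum (λ w → E w u))
    ≡⟨ cong (_+_ (sum (λ u → sum (E u)))) (∑-comm E) ⟨
  sum (λ u → sum (E u)) + sum (λ u → sum (E u))
    ≡⟨ cong (λ m → m + m) (numEdges≡ G) ⟨
  numEdges G + numEdges G
    ≡⟨ cong (_+_ (numEdges G)) (+-identityʳ (numEdges G)) ⟨
  2 * numEdges G
    ∎
  where
  open ≡-Reasoning
  E : Fin n → Fin n → ℕ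
  E u w = bit (does (u <? w) ∧ adj G u w)

-- Exclusive splits

splitGraph : Graph n → Fin n → (Fin n → Bool) → Graph (suc n)
splitGraph G v S = record { adj = splitAdj G v S ; sym = symmetric ; irrefl = irreflexive }
  where
  symmetric : ∀ a b → splitAdj G v S a b ≡ splitAdj G v S b a
  symmetric zero    zero    = refl
  symmetric zero    (suc b) = refl
  symmetric (suc a) zero    = refl
  symmetric (suc a) (suc b) with a ≟ v | b ≟ v
  ... | yes refl | yes refl = refl
  ... | yes refl | no _     = cong (_∧ S b) (adj-sym G a b)
  ... | no _     | yes refl = cong (_∧ S a) (adj-sym G a b)
  ... | no _     | no _     = adj-sym G a b
  irreflexive : ∀ a → splitAdj G v S a a ≡ false
  irreflexive zero = refl
  irreflexive (suc a) with a ≟ v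
  ... | yes refl = cong (_∧ S v) (adj-irrefl G v)
  ... | no _ = adj-irrefl G a

module _ (G : Graph n) (v : Fin n) (S : Fin n → Bool) where

  splitDeg : Fin (suc n) → ℕ
  splitDeg x = count (splitAdj G v S x)

  splitDeg-split : splitDeg (suc v) ≡ count (λ w → adj G v w ∧ S w)
  splitDeg-split rewrite adj-irrefl G v | dec-true (v ≟ v) refl = refl

  splitDeg-other : ∀ {u} → u ≢ v → splitDeg (suc u) ≡ deg G u
  splitDeg-other {u} u≢v rewrite dec-false (u ≟ v) u≢v =
    sum-agree-off v (bit (adj G v u ∧ not (S u))) (λ w w≢v → cong bit (row-other w≢v)) (begin
      bit (adj G v u ∧ not (S u)) + bit (row v)
        ≡⟨ cong (λ b → bit (adj G v u ∧ not (S u)) + bit b) row-v ⟩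
      bit (adj G v u ∧ not (S u)) + bit (adj G u v ∧ S u)
        ≡⟨ cong (λ b → bit (b ∧ not (S u)) + bit (adj G u v ∧ S u)) (adj-sym G v u) ⟩
      bit (adj G u v ∧ not (S u)) + bit (adj G u v ∧ S u)
        ≡⟨ bit-∧-partition (adj G u v) (S u) ⟩
      bit (adj G u v)
        ∎)
    where
    open ≡-Reasoning
    row : Fin n → Bool
    row w = if does (w ≟ v) then adj G u v ∧ S u else adj G u w
    row-v : row v ≡ adj G u v ∧ S u
    row-v rewrite dec-true (v ≟ v) refl = refl
    row-other : ∀ {w} → w ≢ v → row w ≡ adj G u w
    row-other {w} w≢v rewrite dec-false (w ≟ v) w≢v = refl

  splitDeg-sum : sum splitDeg ≡ sum (deg G)
  splitDeg-sum = sum-agree-off v (splitDeg zero) (λ u → splitDeg-other)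
    (trans (cong (_+_ (splitDeg zero)) splitDeg-split) (count-partition (adj G v) S))

exclusiveSplit-∑deg : ∀ {G : Graph n} {G′ : Graph (suc n)} →
                      ExclusiveSplit G G′ → sum (deg G′) ≡ sum (deg G)
exclusiveSplit-∑deg {G = G} (v , S , adj≡) =
  trans (sum-cong-≗ λ x → count-cong (adj≡ x)) (splitDeg-sum G v S)

splitSeq-size : ∀ {n′ j} {G : Graph n} {H : Graph n′} → SplitSeq G H j → n′ ≡ n + j
splitSeq-size {n} done = sym (+-identityʳ n)
splitSeq-size {n} (step {j = j} _ seq) = trans (splitSeq-size seq) (sym (+-suc n j))

splitSeq-∑deg : ∀ {n′ j} {G : Graph n} {H : Graph n′} → SplitSeq G H j → sum (deg H) ≡ sum (deg G)
splitSeq-∑deg done             = refl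
splitSeq-∑deg (step {G′ = G′} split seq) = trans (splitSeq-∑deg seq) (exclusiveSplit-∑deg {G′ = G′} split)

cycleGraph-deg : ∀ (H : Graph n) → IsCycleGraph H → ∀ v → deg H v ≡ 2
cycleGraph-deg H (π , _ , no-2-cycle , adjacent⇒step , step⇒adjacent) v =
  count-exactly-two (adj H v) record
    { distinct = λ eq → no-2-cycle v (trans (cong (π ⟨$⟩ʳ_) eq) (inverseʳ π))
    ; holds₁   = step⇒adjacent v _ (inj₁ refl)
    ; holds₂   = step⇒adjacent v _ (inj₂ (inverseʳ π))
    ; only     = λ {w} adj≡true → Sum.map sym (λ eq → trans (sym (inverseˡ π)) (cong (π ⟨$⟩ˡ_) eq))
                                          (adjacent⇒step v w adj≡true)
    }

splitSeq-cycleGraph⇒numEdges : ∀ {n′ j} (G : Graph n) {H : Graph n′} →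
  SplitSeq G H j → IsCycleGraph H → numEdges G ≡ n + j
splitSeq-cycleGraph⇒numEdges {n} {n′} {j} G {H} seq cycle = *-cancelˡ-≡ (numEdges G) (n + j) 2 (begin
  2 * numEdges G         ≡⟨ handshake G ⟨
  sum (deg G)            ≡⟨ splitSeq-∑deg seq ⟨
  sum (deg H)            ≡⟨ sum-cong-≗ (cycleGraph-deg H cycle) ⟩
  sum {n′} (λ _ → 2)     ≡⟨ sum-const n′ 2 ⟩
  n′ * 2                 ≡⟨ *-comm n′ 2 ⟩
  2 * n′                 ≡⟨ cong (2 *_) (splitSeq-size seq) ⟩
  2 * (n + j)            ∎)
  where open ≡-Reasoning

+[n+j]-+n≡+j : ∀ n j → + (n + j) - + n ≡ + j
+[n+j]-+n≡+j n j = begin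
  + (n + j) - + n      ≡⟨ [+m]-[+n]≡m⊖n (n + j) n ⟩
  (n + j) ⊖ n          ≡⟨ ≤-⊖ (m≤m+n n j) ⟩
  + (n + j ∸ n)        ≡⟨ cong +_ (m+n∸m≡n n j) ⟩
  + j                  ∎
  where open ≡-Reasoning

splitSeq-cycleGraph⇒excess : ∀ {n′ j} (G : Graph n) {H : Graph n′} →
  SplitSeq G H j → IsCycleGraph H → + numEdges G - + n ≡ + j
splitSeq-cycleGraph⇒excess {n} {j = j} G seq cycle =
  trans (cong (λ m → + m - + n) (splitSeq-cycleGraph⇒numEdges G seq cycle)) (+[n+j]-+n≡+j n j)

-- Splitting down to a 2-regular graph

PositiveEven : ℕ → Set
PositiveEven d = Even d × 2 ≤ d

even-≥1⇒≥2 : ∀ {d} → Even d → 1 ≤ d → 2 ≤ d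
even-≥1⇒≥2 (even-ss _) _ = s≤s (s≤s z≤n)

positiveEven-≱4⇒≡2 : ∀ {d} → PositiveEven d → ¬ 4 ≤ d → d ≡ 2
positiveEven-≱4⇒≡2 (even-ss even-zero , _) _ = refl
positiveEven-≱4⇒≡2 (even-ss (even-ss _) , _) 4≰d = ⊥-elim (4≰d (s≤s (s≤s (s≤s (s≤s z≤n)))))

pairSet : Fin n → Fin n → Fin n → Bool
pairSet a b w = does (w ≟ a) ∨ does (w ≟ b)

module _ (G : Graph n) (v : Fin n) {a b : Fin n} (a≢b : a ≢ b)
         (va : adj G v a ≡ true) (vb : adj G v b ≡ true) where

  splitPair-deg : splitDeg G v (pairSet a b) (suc v) ≡ 2
  splitPair-deg = trans (splitDeg-split G v (pairSet a b)) (count-exactly-two _ record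
    { distinct = a≢b ; holds₁ = holds₁ ; holds₂ = holds₂ ; only = only })
    where
    holds₁ : adj G v a ∧ pairSet a b a ≡ true
    holds₁ rewrite va | dec-true (a ≟ a) refl = refl
    holds₂ : adj G v b ∧ pairSet a b b ≡ true
    holds₂ rewrite vb | dec-true (b ≟ b) refl = ∨-zeroʳ (does (b ≟ a))
    only : ∀ {w} → adj G v w ∧ pairSet a b w ≡ true → w ≡ a ⊎ w ≡ b
    only {w} eq with w ≟ a | w ≟ b
    ... | yes w≡a | _       = inj₁ w≡a
    ... | no _    | yes w≡b = inj₂ w≡b
    ... | no _    | no _    = contradiction (trans (sym eq) (∧-zeroʳ (adj G v w))) λ ()

  splitPair-rest : 2 + splitDeg G v (pairSet a b) zero ≡ deg G v
  splitPair-rest = begin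
    2 + splitDeg G v S zero
      ≡⟨ +-comm 2 _ ⟩
    splitDeg G v S zero + 2
      ≡⟨ cong (_+_ (splitDeg G v S zero)) (trans (sym splitPair-deg) (splitDeg-split G v S)) ⟩
    splitDeg G v S zero + count (λ w → adj G v w ∧ S w)
      ≡⟨ count-partition (adj G v) S ⟩
    deg G v
      ∎
    where
    open ≡-Reasoning
    S : Fin n → Bool
    S = pairSet a b

  splitPair-positiveEven : (∀ u → PositiveEven (deg G u)) → 4 ≤ deg G v →
                           ∀ x → PositiveEven (splitDeg G v (pairSet a b) x)
  splitPair-positiveEven even 4≤dv zero =
    even-pred₂ (subst Even (sym splitPair-rest) (proj₁ (even v))) ,
    s≤s⁻¹ (s≤s⁻¹ (subst (4 ≤_) (sym splitPair-rest) 4≤dv))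
    where
    even-pred₂ : ∀ {d} → Even (2 + d) → Even d
    even-pred₂ (even-ss e) = e
  splitPair-positiveEven even 4≤dv (suc u) = old-vertex u (u ≟ v)
    where
    old-vertex : ∀ u → Dec (u ≡ v) → PositiveEven (splitDeg G v (pairSet a b) (suc u))
    old-vertex u (yes refl) = subst PositiveEven (sym splitPair-deg) (even-ss even-zero , ≤-refl)
    old-vertex u (no u≢v)   = subst PositiveEven (sym (splitDeg-other G v _ u≢v)) (even u)

excess-≥2 : ∀ (G : Graph n) {F} v → (∀ u → PositiveEven (deg G u)) → 4 ≤ deg G v →
            sum (deg G) ≤ n * 2 + F → 2 ≤ F
excess-≥2 {n} G {F} v even 4≤dv bound = +-cancelˡ-≤ (n * 2) 2 F
  (subst (_≤ n * 2 + F) (+-comm 2 (n * 2)) (≤-trans (sum-≥-peak v (proj₂ ∘ even) 4≤dv) bound))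

n*2+[2+F]≡[1+n]*2+F : ∀ n F → n * 2 + (2 + F) ≡ suc n * 2 + F
n*2+[2+F]≡[1+n]*2+F n F = trans (+-suc (n * 2) (1 + F)) (cong suc (+-suc (n * 2) F))

ReachesTwoRegular : Graph n → Set
ReachesTwoRegular G = Σ ℕ λ j → Σ ℕ λ n′ → Σ (Graph n′) λ H → SplitSeq G H j × (∀ v → deg H v ≡ 2)

-- F bounds the excess ∑ deg − 2n, which every split of a vertex of degree ≥ 4 lowers by 2.
reachesTwoRegular-fuel : ∀ F (G : Graph n) → (∀ v → PositiveEven (deg G v)) →
                         sum (deg G) ≤ n * 2 + F → ReachesTwoRegular G
reachesTwoRegular-fuel {n} F G even bound with any? (λ v → 4 ≤? deg G v)
... | no  none = 0 , n , G , done , λ v → positiveEven-≱4⇒≡2 (even v) (λ 4≤dv → none (v , 4≤dv))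
... | yes (v , 4≤dv) with m≤n⇒∃[o]m+o≡n (excess-≥2 G v even 4≤dv bound)
                        | count-witnesses₂ (adj G v) (≤-trans (s≤s (s≤s z≤n)) 4≤dv)
...   | F′ , refl | a , b , a≢b , va , vb
  with reachesTwoRegular-fuel F′ (splitGraph G v (pairSet a b))
         (splitPair-positiveEven G v a≢b va vb even 4≤dv)
         (subst₂ _≤_ (sym (splitDeg-sum G v (pairSet a b))) (n*2+[2+F]≡[1+n]*2+F n F′) bound)
...     | j , n′ , H , seq , twoRegular =
  suc j , n′ , H , step (v , pairSet a b , λ _ _ → refl) seq , twoRegular

positiveEven⇒reachesTwoRegular : ∀ (G : Graph n) → (∀ v → PositiveEven (deg G v)) → ReachesTwoRegular G
positiveEven⇒reachesTwoRegular {n} G even =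
  reachesTwoRegular-fuel (sum (deg G)) G even (m≤n+m (sum (deg G)) (n * 2))

-- 2-regular graphs are cycle graphs

x∉p∖x : ∀ {p : Subset n} {x} → x ∉ p ∖ x
x∉p∖x {p = _ ∷ _} {zero}  ()
x∉p∖x {p = _ ∷ _} {suc x} (there x∈p∖x) = x∉p∖x x∈p∖x

x∈p∖y⇒x∈p×x≢y : ∀ {p : Subset n} {x y} → x ∈ p ∖ y → x ∈ p × x ≢ y
x∈p∖y⇒x∈p×x≢y {p = p} {y = y} x∈p∖y = p─q⊆p p ⁅ y ⁆ x∈p∖y , λ { refl → x∉p∖x x∈p∖y }

transpose-matchˡ : ∀ (i j : Fin n) → PC.transpose i j i ≡ j
transpose-matchˡ i j rewrite dec-true (i ≟ i) refl = refl

transpose-matchʳ : ∀ (i j : Fin n) → PC.transpose i j j ≡ i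
transpose-matchʳ i j with j ≟ i
... | yes refl = refl
... | no _ rewrite dec-true (j ≟ j) refl = refl

transpose-other : ∀ {i j k : Fin n} → k ≢ i → k ≢ j → PC.transpose i j k ≡ k
transpose-other {i = i} {j} {k} k≢i k≢j rewrite dec-false (k ≟ i) k≢i | dec-false (k ≟ j) k≢j = refl

record TwoRegularOn (A : Rel (Fin n) 0ℓ) (U : Subset n) : Set where
  field
    symmetric      : Symmetric A
    irreflexive    : ∀ x → ¬ A x x
    isolated       : ∀ {x y} → x ∉ U → ¬ A x y
    two-neighbours : ∀ {x} → x ∈ U → ∃₂ (ExactlyAt (A x))

  adjacent⇒∈ : ∀ {x y} → A x y → x ∈ U
  adjacent⇒∈ {x} Axy with x ∈? U
  ... | yes x∈U = x∈U
  ... | no  x∉U = contradiction Axy (isolated x∉U)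

  adjacent? : ∀ x y → Dec (A x y)
  adjacent? x y with x ∈? U
  ... | no  x∉U = no (isolated x∉U)
  ... | yes x∈U with two-neighbours x∈U
  ...   | _ , _ , exactly = exactlyAt-dec exactly y

-- π steps along every cycle of A in one direction.
record Orientation (A : Rel (Fin n) 0ℓ) (U : Subset n) : Set where
  field
    π             : Permutation′ n
    fixes-outside : ∀ {x} → x ∉ U → π ⟨$⟩ʳ x ≡ x
    step-adjacent : ∀ {x} → x ∈ U → A x (π ⟨$⟩ʳ x)
    no-2-cycle    : ∀ {x} → x ∈ U → π ⟨$⟩ʳ (π ⟨$⟩ʳ x) ≢ x

  π-injective : ∀ {x y} → π ⟨$⟩ʳ x ≡ π ⟨$⟩ʳ y → x ≡ y
  π-injective {x} {y} eq = trans (sym (inverseˡ π)) (trans (cong (π ⟨$⟩ˡ_) eq) (inverseˡ π))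

  π-reflects-∈ : ∀ {x} → π ⟨$⟩ʳ x ∈ U → x ∈ U
  π-reflects-∈ {x} πx∈U with x ∈? U
  ... | yes x∈U = x∈U
  ... | no  x∉U = contradiction (subst (_∈ U) (fixes-outside x∉U) πx∈U) x∉U

module _ {A : Rel (Fin n) 0ℓ} {U} (regular : TwoRegularOn A U) (O : Orientation A U) where
  open TwoRegularOn regular
  open Orientation O

  orientation-sound : ∀ {x y} → A x y → π ⟨$⟩ʳ x ≡ y ⊎ π ⟨$⟩ʳ y ≡ x
  orientation-sound {x} Axy with two-neighbours (adjacent⇒∈ Axy)
  ... | _ , _ , exactly =
    Sum.map sym (λ y≡π⁻x → trans (cong (π ⟨$⟩ʳ_) y≡π⁻x) (inverseʳ π)) (ExactlyAt.only around-x Axy)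
    where
    x∈U : x ∈ U
    x∈U = adjacent⇒∈ Axy
    π⁻x∈U : π ⟨$⟩ˡ x ∈ U
    π⁻x∈U = π-reflects-∈ (subst (_∈ U) (sym (inverseʳ π)) x∈U)
    around-x : ExactlyAt (A x) (π ⟨$⟩ʳ x) (π ⟨$⟩ˡ x)
    around-x = exactlyAt-reselect exactly (step-adjacent x∈U)
      (symmetric (subst (A _) (inverseʳ π) (step-adjacent π⁻x∈U)))
      (λ eq → no-2-cycle x∈U (trans (cong (π ⟨$⟩ʳ_) eq) (inverseʳ π)))

  orientation-complete : ∀ {x y} → x ∈ U → π ⟨$⟩ʳ x ≡ y ⊎ π ⟨$⟩ʳ y ≡ x → A x y
  orientation-complete x∈U (inj₁ refl) = step-adjacent x∈U
  orientation-complete {x} {y} x∈U (inj₂ πy≡x) =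
    symmetric (subst (A y) πy≡x (step-adjacent (π-reflects-∈ (subst (_∈ U) (sym πy≡x) x∈U))))

identity-orientation : ∀ {A : Rel (Fin n) 0ℓ} {U} → Empty U → Orientation A U
identity-orientation empty = record
  { π             = Perm.id
  ; fixes-outside = λ _ → refl
  ; step-adjacent = λ x∈U → ⊥-elim (empty (_ , x∈U))
  ; no-2-cycle    = λ x∈U → ⊥-elim (empty (_ , x∈U))
  }

_↾_ : Rel (Fin n) 0ℓ → Subset n → Rel (Fin n) 0ℓ
(A ↾ V) x y = x ∈ V × y ∈ V × A x y

module Triangle {A : Rel (Fin n) 0ℓ} {U} (regular : TwoRegularOn A U)
                {u a b} (u∈U : u ∈ U) (around-u : ExactlyAt (A u) a b) (Aab : A a b) where
  open TwoRegularOn regular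
  open ExactlyAt around-u

  U′ : Subset n
  U′ = U ∖ u ∖ a ∖ b

  Off : Fin n → Set
  Off x = x ≢ u × x ≢ a × x ≢ b

  position : ∀ x → x ≡ u ⊎ x ≡ a ⊎ x ≡ b ⊎ Off x
  position x with x ≟ u | x ≟ a | x ≟ b
  ... | yes x≡u | _       | _       = inj₁ x≡u
  ... | no _    | yes x≡a | _       = inj₂ (inj₁ x≡a)
  ... | no _    | no _    | yes x≡b = inj₂ (inj₂ (inj₁ x≡b))
  ... | no x≢u  | no x≢a  | no x≢b  = inj₂ (inj₂ (inj₂ (x≢u , x≢a , x≢b)))

  ∈U′⁺ : ∀ {x} → x ∈ U → Off x → x ∈ U′
  ∈U′⁺ x∈U (x≢u , x≢a , x≢b) = x∈p∧x≢y⇒x∈p-y (x∈p∧x≢y⇒x∈p-y (x∈p∧x≢y⇒x∈p-y x∈U x≢u) x≢a) x≢b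

  ∈U′⁻ : ∀ {x} → x ∈ U′ → x ∈ U × Off x
  ∈U′⁻ x∈U′ with x∈p∖y⇒x∈p×x≢y x∈U′
  ... | x∈U-u-a , x≢b with x∈p∖y⇒x∈p×x≢y x∈U-u-a
  ...   | x∈U-u , x≢a with x∈p∖y⇒x∈p×x≢y x∈U-u
  ...     | x∈U , x≢u = x∈U , x≢u , x≢a , x≢b

  around-a : ExactlyAt (A a) u b
  around-a = exactlyAt-reselect (proj₂ (proj₂ (two-neighbours (adjacent⇒∈ Aab))))
    (symmetric holds₁) Aab λ { refl → irreflexive u holds₂ }

  around-b : ExactlyAt (A b) u a
  around-b = exactlyAt-reselect (proj₂ (proj₂ (two-neighbours (adjacent⇒∈ (symmetric Aab)))))
    (symmetric holds₂) (symmetric Aab) λ { refl → irreflexive u holds₁ }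

  off-closed : ∀ {x y} → Off x → A x y → Off y
  off-closed (x≢u , x≢a , x≢b) Axy =
      (λ { refl → [ x≢a , x≢b ]′ (only (symmetric Axy)) })
    , (λ { refl → [ x≢u , x≢b ]′ (ExactlyAt.only around-a (symmetric Axy)) })
    , (λ { refl → [ x≢u , x≢a ]′ (ExactlyAt.only around-b (symmetric Axy)) })

  regular′ : TwoRegularOn (A ↾ U′) U′
  regular′ = record
    { symmetric      = λ (x∈ , y∈ , Axy) → y∈ , x∈ , symmetric Axy
    ; irreflexive    = λ x (_ , _ , Axx) → irreflexive x Axx
    ; isolated       = λ x∉U′ (x∈U′ , _) → x∉U′ x∈U′
    ; two-neighbours = neighbours′
    }
    where
    neighbours′ : ∀ {x} → x ∈ U′ → ∃₂ (ExactlyAt ((A ↾ U′) x))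
    neighbours′ {x} x∈U′ with ∈U′⁻ x∈U′
    ... | x∈U , off-x with two-neighbours x∈U
    ...   | p , q , around-x = p , q , record
      { distinct = X.distinct
      ; holds₁   = x∈U′ , in-U′ X.holds₁ , X.holds₁
      ; holds₂   = x∈U′ , in-U′ X.holds₂ , X.holds₂
      ; only     = λ (_ , _ , Axw) → X.only Axw
      }
      where
      module X = ExactlyAt around-x
      in-U′ : ∀ {y} → A x y → y ∈ U′
      in-U′ Axy = ∈U′⁺ (adjacent⇒∈ (symmetric Axy)) (off-closed off-x Axy)

  smaller : ∣ U′ ∣ < ∣ U ∣
  smaller = ≤-<-trans (≤-trans (∣p─q∣≤∣p∣ (U ∖ u ∖ a) ⁅ b ⁆) (∣p─q∣≤∣p∣ (U ∖ u) ⁅ a ⁆))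
                      (x∈p⇒∣p-x∣<∣p∣ u∈U)

  module Extend (O′ : Orientation (A ↾ U′) U′) where
    private module O′ = Orientation O′

    a∈U : a ∈ U
    a∈U = adjacent⇒∈ Aab
    b∈U : b ∈ U
    b∈U = adjacent⇒∈ (symmetric Aab)
    u≢a : u ≢ a
    u≢a refl = irreflexive u holds₁
    u≢b : u ≢ b
    u≢b refl = irreflexive u holds₂

    π′-fixes-triangle : ∀ {x} → ¬ Off x → O′.π ⟨$⟩ʳ x ≡ x
    π′-fixes-triangle ¬off = O′.fixes-outside (¬off ∘ proj₂ ∘ ∈U′⁻)

    π : Permutation′ n
    π = transpose a b ∘ₚ transpose u a ∘ₚ O′.π

    π-u : π ⟨$⟩ʳ u ≡ a
    π-u rewrite transpose-other u≢a u≢b | transpose-matchˡ u a =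
      π′-fixes-triangle λ off → proj₁ (proj₂ off) refl
    π-a : π ⟨$⟩ʳ a ≡ b
    π-a rewrite transpose-matchˡ a b | transpose-other (u≢b ∘ sym) (distinct ∘ sym) =
      π′-fixes-triangle λ off → proj₂ (proj₂ off) refl
    π-b : π ⟨$⟩ʳ b ≡ u
    π-b rewrite transpose-matchʳ a b | transpose-matchʳ u a =
      π′-fixes-triangle λ off → proj₁ off refl
    π-off : ∀ {x} → Off x → π ⟨$⟩ʳ x ≡ O′.π ⟨$⟩ʳ x
    π-off (x≢u , x≢a , x≢b) rewrite transpose-other x≢a x≢b | transpose-other x≢u x≢a = refl

    fixes-outside : ∀ {x} → x ∉ U → π ⟨$⟩ʳ x ≡ x
    fixes-outside {x} x∉U = trans (π-off off) (O′.fixes-outside (x∉U ∘ proj₁ ∘ ∈U′⁻))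
      where
      off : Off x
      off = (λ { refl → x∉U u∈U }) , (λ { refl → x∉U a∈U }) , (λ { refl → x∉U b∈U })

    step-adjacent : ∀ {x} → x ∈ U → A x (π ⟨$⟩ʳ x)
    step-adjacent {x} x∈U with position x
    ... | inj₁ refl               = subst (A u) (sym π-u) holds₁
    ... | inj₂ (inj₁ refl)        = subst (A a) (sym π-a) Aab
    ... | inj₂ (inj₂ (inj₁ refl)) = subst (A b) (sym π-b) (symmetric holds₂)
    ... | inj₂ (inj₂ (inj₂ off))  =
      subst (A x) (sym (π-off off)) (proj₂ (proj₂ (O′.step-adjacent (∈U′⁺ x∈U off))))

    no-2-cycle : ∀ {x} → x ∈ U → π ⟨$⟩ʳ (π ⟨$⟩ʳ x) ≢ x
    no-2-cycle {x} x∈U with position x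
    ... | inj₁ refl               = λ eq → u≢b (trans (sym eq) (trans (cong (π ⟨$⟩ʳ_) π-u) π-a))
    ... | inj₂ (inj₁ refl)        = λ eq → u≢a (sym (trans (sym eq) (trans (cong (π ⟨$⟩ʳ_) π-a) π-b)))
    ... | inj₂ (inj₂ (inj₁ refl)) = λ eq → distinct (sym (trans (sym eq) (trans (cong (π ⟨$⟩ʳ_) π-b) π-u)))
    ... | inj₂ (inj₂ (inj₂ off))  = λ eq → O′.no-2-cycle x∈U′ (trans (sym π²-off) eq)
      where
      x∈U′ : x ∈ U′
      x∈U′ = ∈U′⁺ x∈U off
      π²-off : π ⟨$⟩ʳ (π ⟨$⟩ʳ x) ≡ O′.π ⟨$⟩ʳ (O′.π ⟨$⟩ʳ x)
      π²-off = trans (cong (π ⟨$⟩ʳ_) (π-off off))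
                     (π-off (proj₂ (∈U′⁻ (proj₁ (proj₂ (O′.step-adjacent x∈U′))))))

    extended : Orientation A U
    extended = record
      { π = π ; fixes-outside = fixes-outside ; step-adjacent = step-adjacent ; no-2-cycle = no-2-cycle }

  extend : Orientation (A ↾ U′) U′ → Orientation A U
  extend = Extend.extended

-- Delete u and join its neighbours pairwise; for u of degree 2 this suppresses u.
suppress : Rel (Fin n) 0ℓ → Fin n → Rel (Fin n) 0ℓ
suppress A u x y = (x ≢ u × y ≢ u × A x y) ⊎ (A u x × A u y × x ≢ y)

module Suppress {A : Rel (Fin n) 0ℓ} {U} (regular : TwoRegularOn A U)
                {u a b} (u∈U : u ∈ U) (around-u : ExactlyAt (A u) a b) (¬Aab : ¬ A a b) where
  open TwoRegularOn regular

  U′ : Subset n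
  U′ = U ∖ u

  ¬A-neighbours : ∀ {x y} → ExactlyAt (A u) x y → ¬ A x y
  ¬A-neighbours around with ExactlyAt.only around-u (ExactlyAt.holds₁ around)
                          | ExactlyAt.only around-u (ExactlyAt.holds₂ around)
  ... | inj₁ refl | inj₂ refl = ¬Aab
  ... | inj₂ refl | inj₁ refl = ¬Aab ∘ symmetric
  ... | inj₁ refl | inj₁ refl = contradiction refl (ExactlyAt.distinct around)
  ... | inj₂ refl | inj₂ refl = contradiction refl (ExactlyAt.distinct around)

  symmetric′ : Symmetric (suppress A u)
  symmetric′ (inj₁ (x≢u , y≢u , Axy))  = inj₁ (y≢u , x≢u , symmetric Axy)
  symmetric′ (inj₂ (Aux , Auy , x≢y)) = inj₂ (Auy , Aux , x≢y ∘ sym)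

  irreflexive′ : ∀ x → ¬ suppress A u x x
  irreflexive′ x (inj₁ (_ , _ , Axx)) = irreflexive x Axx
  irreflexive′ x (inj₂ (_ , _ , x≢x)) = x≢x refl

  isolated′ : ∀ {x y} → x ∉ U′ → ¬ suppress A u x y
  isolated′ {x} x∉U′ with x ≟ u
  ... | yes refl = λ { (inj₁ (u≢u , _)) → u≢u refl ; (inj₂ (Auu , _)) → irreflexive u Auu }
  ... | no x≢u   = λ { (inj₁ (_ , _ , Axy)) → isolated x∉U Axy
                     ; (inj₂ (Aux , _))     → isolated x∉U (symmetric Aux) }
    where
    x∉U : x ∉ U
    x∉U x∈U = x∉U′ (x∈p∧x≢y⇒x∈p-y x∈U x≢u)

  two-neighbours-near-u : ∀ {x} → x ∈ U → x ≢ u → A u x → ∃₂ (ExactlyAt (suppress A u x))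
  two-neighbours-near-u {x} x∈U x≢u Aux with exactlyAt-other around-u Aux
                          | exactlyAt-other (proj₂ (proj₂ (two-neighbours x∈U))) (symmetric Aux)
  ... | y , around-u′ | c , around-x = c , y , record
    { distinct = λ c≡y → ¬A-neighbours around-u′ (subst (A x) c≡y X.holds₂)
    ; holds₁   = inj₁ (x≢u , X.distinct ∘ sym , X.holds₂)
    ; holds₂   = inj₂ (Aux , Y.holds₂ , Y.distinct)
    ; only     = λ
        { (inj₁ (_ , w≢u , Axw)) → inj₁ ([ (λ w≡u → contradiction w≡u w≢u) , id ]′ (X.only Axw))
        ; (inj₂ (_ , Auw , x≢w)) → inj₂ ([ (λ w≡x → contradiction (sym w≡x) x≢w) , id ]′ (Y.only Auw))
        }
    }
    where
    module X = ExactlyAt around-x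
    module Y = ExactlyAt around-u′

  two-neighbours-far-from-u : ∀ {x} → x ∈ U → x ≢ u → ¬ A u x → ∃₂ (ExactlyAt (suppress A u x))
  two-neighbours-far-from-u {x} x∈U x≢u ¬Aux with two-neighbours x∈U
  ... | p , q , around-x = p , q , record
    { distinct = X.distinct
    ; holds₁   = inj₁ (x≢u , ≢u X.holds₁ , X.holds₁)
    ; holds₂   = inj₁ (x≢u , ≢u X.holds₂ , X.holds₂)
    ; only     = λ { (inj₁ (_ , _ , Axw)) → X.only Axw ; (inj₂ (Aux , _)) → contradiction Aux ¬Aux }
    }
    where
    module X = ExactlyAt around-x
    ≢u : ∀ {y} → A x y → y ≢ u
    ≢u Axy refl = ¬Aux (symmetric Axy)

  two-neighbours′ : ∀ {x} → x ∈ U′ → ∃₂ (ExactlyAt (suppress A u x))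
  two-neighbours′ {x} x∈U′ with x∈p∖y⇒x∈p×x≢y x∈U′
  ... | x∈U , x≢u with adjacent? u x
  ...   | yes Aux = two-neighbours-near-u x∈U x≢u Aux
  ...   | no ¬Aux = two-neighbours-far-from-u x∈U x≢u ¬Aux

  regular′ : TwoRegularOn (suppress A u) U′
  regular′ = record
    { symmetric      = symmetric′
    ; irreflexive    = irreflexive′
    ; isolated       = isolated′
    ; two-neighbours = two-neighbours′
    }

  smaller : ∣ U′ ∣ < ∣ U ∣
  smaller = x∈p⇒∣p-x∣<∣p∣ u∈U

  -- π′ crosses the new edge {p, q} only as p → q, and π replaces that step by p → u → q.
  module Insert {p q} (around : ExactlyAt (A u) p q) (O′ : Orientation (suppress A u) U′)
                (π′p≡q : Orientation.π O′ ⟨$⟩ʳ p ≡ q) where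
    open ExactlyAt around
    private module O′ = Orientation O′
    π′ : Permutation′ n
    π′ = O′.π
    π : Permutation′ n
    π = transpose p u ∘ₚ π′

    p≢u : p ≢ u
    p≢u refl = irreflexive u holds₁
    q≢u : q ≢ u
    q≢u refl = irreflexive u holds₂
    π′u≡u : π′ ⟨$⟩ʳ u ≡ u
    π′u≡u = O′.fixes-outside x∉p∖x
    p∈U′ : p ∈ U′
    p∈U′ = x∈p∧x≢y⇒x∈p-y (adjacent⇒∈ (symmetric holds₁)) p≢u

    π-p : π ⟨$⟩ʳ p ≡ u
    π-p rewrite transpose-matchˡ p u = π′u≡u
    π-u : π ⟨$⟩ʳ u ≡ q
    π-u rewrite transpose-matchʳ p u = π′p≡q
    π-other : ∀ {x} → x ≢ p → x ≢ u → π ⟨$⟩ʳ x ≡ π′ ⟨$⟩ʳ x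
    π-other x≢p x≢u rewrite transpose-other x≢p x≢u = refl

    position : ∀ x → x ≡ p ⊎ x ≡ u ⊎ x ≢ p × x ≢ u
    position x with x ≟ p | x ≟ u
    ... | yes x≡p | _       = inj₁ x≡p
    ... | no _    | yes x≡u = inj₂ (inj₁ x≡u)
    ... | no x≢p  | no x≢u  = inj₂ (inj₂ (x≢p , x≢u))

    fixes-outside : ∀ {x} → x ∉ U → π ⟨$⟩ʳ x ≡ x
    fixes-outside {x} x∉U =
      trans (π-other (λ { refl → x∉U (proj₁ (x∈p∖y⇒x∈p×x≢y p∈U′)) }) (λ { refl → x∉U u∈U }))
            (O′.fixes-outside (x∉U ∘ proj₁ ∘ x∈p∖y⇒x∈p×x≢y))

    step-adjacent : ∀ {x} → x ∈ U → A x (π ⟨$⟩ʳ x)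
    step-adjacent {x} x∈U with position x
    ... | inj₁ refl                = subst (A p) (sym π-p) (symmetric holds₁)
    ... | inj₂ (inj₁ refl)         = subst (A u) (sym π-u) holds₂
    ... | inj₂ (inj₂ (x≢p , x≢u)) with O′.step-adjacent (x∈p∧x≢y⇒x∈p-y x∈U x≢u)
    ...   | inj₁ (_ , _ , Axy)       = subst (A x) (sym (π-other x≢p x≢u)) Axy
    ...   | inj₂ (Aux , Auy , x≢y) with only Aux | only Auy
    ...     | inj₁ x≡p | _        = contradiction x≡p x≢p
    ...     | inj₂ refl | inj₂ y≡q = contradiction (sym y≡q) x≢y
    ...     | inj₂ refl | inj₁ y≡p =
      ⊥-elim (O′.no-2-cycle p∈U′ (trans (cong (π′ ⟨$⟩ʳ_) π′p≡q) y≡p))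

    π²-p : π ⟨$⟩ʳ (π ⟨$⟩ʳ p) ≡ q
    π²-p = trans (cong (π ⟨$⟩ʳ_) π-p) π-u
    π²-u : π ⟨$⟩ʳ (π ⟨$⟩ʳ u) ≡ π′ ⟨$⟩ʳ q
    π²-u = trans (cong (π ⟨$⟩ʳ_) π-u) (π-other (distinct ∘ sym) q≢u)

    no-2-cycle : ∀ {x} → x ∈ U → π ⟨$⟩ʳ (π ⟨$⟩ʳ x) ≢ x
    no-2-cycle {x} x∈U with position x
    ... | inj₁ refl               = λ eq → distinct (trans (sym eq) π²-p)
    ... | inj₂ (inj₁ refl)        = λ eq → q≢u (O′.π-injective (trans (trans (sym π²-u) eq) (sym π′u≡u)))
    ... | inj₂ (inj₂ (x≢p , x≢u)) with π′ ⟨$⟩ʳ x ≟ p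
    ...   | yes π′x≡p = λ eq → x≢u (trans (sym eq) π²-x)
      where
      π²-x : π ⟨$⟩ʳ (π ⟨$⟩ʳ x) ≡ u
      π²-x = trans (cong (π ⟨$⟩ʳ_) (trans (π-other x≢p x≢u) π′x≡p)) π-p
    ...   | no π′x≢p  = λ eq → O′.no-2-cycle (x∈p∧x≢y⇒x∈p-y x∈U x≢u) (trans (sym π²-x) eq)
      where
      π′x≢u : π′ ⟨$⟩ʳ x ≢ u
      π′x≢u π′x≡u = x≢u (O′.π-injective (trans π′x≡u (sym π′u≡u)))
      π²-x : π ⟨$⟩ʳ (π ⟨$⟩ʳ x) ≡ π′ ⟨$⟩ʳ (π′ ⟨$⟩ʳ x)
      π²-x = trans (cong (π ⟨$⟩ʳ_) (π-other x≢p x≢u)) (π-other π′x≢p π′x≢u)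

    inserted : Orientation A U
    inserted = record
      { π = π ; fixes-outside = fixes-outside ; step-adjacent = step-adjacent ; no-2-cycle = no-2-cycle }

  extend : Orientation (suppress A u) U′ → Orientation A U
  extend O′ with orientation-sound regular′ O′ (inj₂ (holds₁ , holds₂ , distinct))
    where open ExactlyAt around-u
  ... | inj₁ π′a≡b = Insert.inserted around-u O′ π′a≡b
  ... | inj₂ π′b≡a = Insert.inserted (exactlyAt-reselect around-u holds₂ holds₁ (distinct ∘ sym)) O′ π′b≡a
    where open ExactlyAt around-u

orientation : ∀ {A : Rel (Fin n) 0ℓ} {U} → TwoRegularOn A U → Acc _<_ ∣ U ∣ → Orientation A U
orientation {U = U} regular (acc rec) with nonempty? U
... | no empty = identity-orientation empty
... | yes (u , u∈U) with TwoRegularOn.two-neighbours regular u∈U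
...   | a , b , around-u with TwoRegularOn.adjacent? regular a b
...     | yes Aab = T.extend (orientation T.regular′ (rec T.smaller))
  where module T = Triangle regular u∈U around-u Aab
...     | no ¬Aab = S.extend (orientation S.regular′ (rec S.smaller))
  where module S = Suppress regular u∈U around-u ¬Aab

twoRegular⇒cycleGraph : ∀ (H : Graph n) → (∀ v → deg H v ≡ 2) → IsCycleGraph H
twoRegular⇒cycleGraph {n} H twoRegular =
    π
  , (λ v πv≡v → not-¬ (subst (Adj v) πv≡v (step-adjacent ∈⊤)) (adj-irrefl H v))
  , (λ v → no-2-cycle ∈⊤)
  , (λ u w → orientation-sound regular O)
  , (λ u w → orientation-complete regular O ∈⊤)
  where
  Adj : Rel (Fin n) 0ℓ
  Adj u w = adj H u w ≡ true
  regular : TwoRegularOn Adj ⊤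
  regular = record
    { symmetric      = λ {u} {w} → trans (adj-sym H w u)
    ; irreflexive    = λ u Auu → not-¬ Auu (adj-irrefl H u)
    ; isolated       = λ u∉⊤ → contradiction ∈⊤ u∉⊤
    ; two-neighbours = λ {u} _ → count≡2⇒exactly-two (adj H u) (twoRegular u)
    }
  O : Orientation Adj ⊤
  O = orientation regular (<-wellFounded _)
  open Orientation O

theorem4 : ∀ {n} (G : Graph n) (k : ℕ) → 1 ≤ k →
    (∀ v → Even (degree G v)) →
    (∀ v → 1 ≤ degree G v) →
    (Σ ℕ λ j → j ≤ k × Σ ℕ λ n′ → Σ (Graph n′) λ H → SplitSeq G H j × IsCycleGraph H)
      ⇔ ((+ numEdges G) - (+ n) ℤ.≤ + k)
theorem4 {n} G k _ even positive = mk⇔ to from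
  where
  CycleGraphWithin : Set
  CycleGraphWithin = Σ ℕ λ j → j ≤ k × Σ ℕ λ n′ → Σ (Graph n′) λ H → SplitSeq G H j × IsCycleGraph H

  to : CycleGraphWithin → + numEdges G - + n ℤ.≤ + k
  to (j , j≤k , _ , _ , seq , cycle) =
    subst (ℤ._≤ + k) (sym (splitSeq-cycleGraph⇒excess G seq cycle)) (ℤ.+≤+ j≤k)

  from : + numEdges G - + n ℤ.≤ + k → CycleGraphWithin
  from excess≤k with positiveEven⇒reachesTwoRegular G (λ v →
                       subst PositiveEven (degree≡deg G v) (even v , even-≥1⇒≥2 (even v) (positive v)))
  ... | j , n′ , H , seq , twoRegular =
    j , drop‿+≤+ (subst (ℤ._≤ + k) (splitSeq-cycleGraph⇒excess G seq cycle) excess≤k) , n′ , H , seq , cycle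
    where
    cycle : IsCycleGraph H
    cycle = twoRegular⇒cycleGraph H twoRegular
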